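{- Let $\Delta\ge 2$ be an integer, let $G$ be an input graph in which every vertex has degree at most $\Delta$, revealed in an admissible order, and run $\lceil\sqrt{\Delta}\rceil$-DOMINATE on it. Let $H$ be the set of heavy vertices and $OPT$ a minimum dominating set of $G$. Then $\frac{|H|}{|OPT|}\le \sqrt{\Delta}+\frac{1}{\sqrt{\Delta}}$.
   Context: Online dominating set model: a finite connected simple undirected graph $G$ is revealed in an order $v_1,\dots,v_n$ such that for every $i$ the subgraph induced on $\{v_1,\dots,v_i\}$ is connected; at step $i$, $v_i$ is revealed together with its entire closed neighbourhood $N[v_i]$, and the algorithm irrevocably decides whether to select $v_i$. Notation: $R_i=\{v_1,\dots,v_i\}$, $V_i=N[R_i]$; $S_i$ = vertices among $v_1,\dots,v_i$ selected, $S_0=\emptyset$; $D_i=N[S_i]$; $U_i=V_i\setminus D_{i-1}$. $v_j$ saves $v_i$ if $j=\max\{k: v_k\in N[v_i]\}$ and $N[v_i]\setminus\{v_j\}$ contains no vertex of $S_{j-1}$; $s(v_j)$ is the set of vertices saved by $v_j$. The algorithm $k$-DOMINATE selects $v_i$ iff $|N(v_i)\cap U_i|\ge k$ or $|s(v_i)|\ge1$. A selected vertex $v_i$ is heavy if $|N(v_i)\cap U_i|\ge\lceil\sqrt{\Delta}\rceil$. -}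

module Defs where

open import Data.Nat using (ℕ; zero; suc; _+_; _*_; _∸_; _≤_; _<_; _≤ᵇ_; _≡ᵇ_)
open import Data.Fin using (Fin; toℕ)
open import Data.Bool using (Bool; true; false; T; _∧_; _∨_; not; if_then_else_)
open import Data.List using (List; length; filterᵇ)
open import Data.Bool.ListAction using (any; all)
open import Data.List using () renaming (allFin to allFinL)
open import Data.Fin using (_≟_)
open import Relation.Nullary.Decidable using (⌊_⌋)
open import Relation.Binary.PropositionalEquality using (_≡_)

-- Vertices of an n-vertex graph are Fin n.  The revelation order is encoded
-- by the labelling: v_{i+1} (paper, 1-based) is the vertex with toℕ = i.
record Graph (n : ℕ) : Set where
  field
    adj    : Fin n → Fin n → Bool
    sym    : ∀ u v → adj u v ≡ adj v u
    irrefl : ∀ v → adj v v ≡ false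
open Graph public

module _ {n : ℕ} where

  verts : List (Fin n)
  verts = allFinL n

  card : (Fin n → Bool) → ℕ
  card p = length (filterᵇ p verts)

  eqᵇ : Fin n → Fin n → Bool
  eqᵇ u v = ⌊ u ≟ v ⌋

  inN[_] : Graph n → Fin n → Fin n → Bool
  inN[ G ] v u = eqᵇ u v ∨ adj G v u

  deg : Graph n → Fin n → ℕ
  deg G v = card (adj G v)

  dom : Graph n → (Fin n → Bool) → Fin n → Bool
  dom G S u = any (λ w → S w ∧ inN[ G ] w u) verts

  data Walk (G : Graph n) (P : Fin n → Bool) : Fin n → Fin n → Set where
    here  : ∀ {u} → T (P u) → Walk G P u u
    step  : ∀ {u w v} → T (P u) → T (adj G u w) → Walk G P w v → Walk G P u v

  InducedConnected : Graph n → (Fin n → Bool) → Set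
  InducedConnected G P = ∀ u v → T (P u) → T (P v) → Walk G P u v

  -- R_i = {v_1,…,v_i}: vertices with index < i
  prefix : ℕ → Fin n → Bool
  prefix i v = suc (toℕ v) ≤ᵇ i

  Admissible : Graph n → Set
  Admissible G = ∀ i → i ≤ n → InducedConnected G (prefix i)

  -- number of neighbours of v not dominated by the set S (= |N(v) ∩ U| where
  -- S is the set of previously selected vertices; N(v) ⊆ V_i automatically)
  newNbrs : Graph n → (Fin n → Bool) → Fin n → ℕ
  newNbrs G S v = card (λ u → adj G v u ∧ not (dom G S u))

  -- v saves u (S = vertices selected before v): v is the last-revealed vertex
  -- of N[u] and N[u] ∖ {v} contains no vertex of S
  saves : Graph n → (Fin n → Bool) → Fin n → Fin n → Bool
  saves G S v u =
    inN[ G ] u v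
    ∧ all (λ w → not (inN[ G ] u w) ∨ (toℕ w ≤ᵇ toℕ v)) verts
    ∧ all (λ w → not (inN[ G ] u w) ∨ eqᵇ w v ∨ not (S w)) verts

  decide : ℕ → Graph n → (Fin n → Bool) → Fin n → Bool
  decide k G S v = (k ≤ᵇ newNbrs G S v) ∨ (1 ≤ᵇ card (saves G S v))

  selected : ℕ → Graph n → ℕ → Fin n → Bool
  selected k G zero    v = false
  selected k G (suc i) v =
    if toℕ v ≡ᵇ i then decide k G (selected k G i) v else selected k G i v

  -- heavy vertices (threshold t = ⌈√Δ⌉): selected and |N(v) ∩ U_v| ≥ t
  heavy : ℕ → ℕ → Graph n → Fin n → Bool
  heavy k t G v =
    decide k G (selected k G (toℕ v)) v ∧ (t ≤ᵇ newNbrs G (selected k G (toℕ v)) v)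

  Dominating : Graph n → (Fin n → Bool) → Set
  Dominating G D = ∀ u → T (dom G D u)

  MinimumDominating : Graph n → (Fin n → Bool) → Set
  MinimumDominating G D =
    Dominating G D × (∀ D′ → Dominating G D′ → card D ≤ card D′)
    where open import Data.Product using (_×_)

IsCeilSqrt : ℕ → ℕ → Set
IsCeilSqrt Δ k = ((k ∸ 1) * (k ∸ 1) < Δ) × (Δ ≤ k * k)
  where open import Data.Product using (_×_)

-- When a heavy vertex is selected it dominates at least ⌈√Δ⌉ vertices that were not dominated
-- before, and domination never gets undone, so |H|·⌈√Δ⌉ ≤ n.  Every vertex of a dominating set
-- covers at most Δ + 1 vertices, so n ≤ |OPT|·(Δ + 1).  Hence |H|·⌈√Δ⌉ ≤ |OPT|·(Δ + 1), and
-- squaring together with Δ ≤ ⌈√Δ⌉² gives |H|²·Δ ≤ |OPT|²·(Δ + 1)², the square of the claimed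
-- ratio bound.
module Submission where

open import Defs
open import Data.Nat using (ℕ; _*_; _+_; _≤_)
open import Data.Fin using (Fin)
open import Data.Bool using (Bool)

open import Data.Nat using (zero; suc; _≡ᵇ_; z≤n; s≤s; s≤s⁻¹)
open import Data.Nat.Properties
open import Data.Fin using (toℕ; fromℕ<)
open import Data.Fin.Properties using (toℕ-injective; toℕ-fromℕ<; toℕ<n)
open import Data.Bool using (true; false; T; _∧_; _∨_; not)
open import Data.Bool.Properties using (T?; T-∧; T-∨; T-≡; T-not-≡)
open import Data.List using (List; []; _∷_; length; filterᵇ)
open import Data.Bool.ListAction using (any)
open import Data.List.Properties using (length-filter; filter-all; filter-none; length-tabulate)
open import Data.List.Membership.Propositional.Properties using (∈-allFin)
open import Data.List.Relation.Unary.All as All using (All)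
open import Data.List.Relation.Unary.Any as Any using ()
open import Data.List.Relation.Unary.Any.Properties using (any⁺; any⁻)
open import Data.List.Relation.Unary.AllPairs using (_∷_)
open import Data.List.Relation.Unary.Unique.Propositional using (Unique)
open import Data.List.Relation.Unary.Unique.Propositional.Properties using (allFin⁺)
open import Data.List.Relation.Binary.Sublist.Propositional using (⊆-refl)
open import Data.List.Relation.Binary.Sublist.Propositional.Properties using (filter⁺)
open import Data.List.Relation.Binary.Sublist.Heterogeneous.Properties using (length-mono-≤)
open import Data.Product using (_,_; proj₁; proj₂)
open import Data.Sum using (_⊎_; inj₁; inj₂; map₁; map₂)
open import Data.Empty using (⊥-elim)
open import Function using (_∘_; module Equivalence)
open import Relation.Nullary using (¬_; yes; no)
open import Relation.Nullary.Decidable using (toWitness; fromWitness)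
open import Relation.Binary.PropositionalEquality as ≡ using (_≡_; refl; cong; subst)

open Equivalence using (to; from)

count : {A : Set} → (A → Bool) → List A → ℕ
count p xs = length (filterᵇ p xs)

module _ {A : Set} where

  count-mono : {p q : A → Bool} → (∀ x → T (p x) → T (q x)) → ∀ xs → count p xs ≤ count q xs
  count-mono {p} {q} p⇒q xs =
    length-mono-≤ (filter⁺ (T? ∘ p) (T? ∘ q) (λ { refl → p⇒q _ }) (⊆-refl {x = xs}))

  count-none : {p : A → Bool} {xs : List A} → All (λ x → ¬ T (p x)) xs → count p xs ≡ 0
  count-none {p} none = cong length (filter-none (T? ∘ p) none)

  count-universal : {p : A → Bool} → (∀ x → T (p x)) → ∀ xs → count p xs ≡ length xs
  count-universal {p} all xs = cong length (filter-all (T? ∘ p) (All.universal all xs))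

  count-∨ : ∀ (p q : A → Bool) xs → count (λ x → p x ∨ q x) xs ≤ count p xs + count q xs
  count-∨ p q [] = z≤n
  count-∨ p q (x ∷ xs) with p x | q x
  ... | true  | true  = s≤s (≤-trans (count-∨ p q xs) (+-monoʳ-≤ (count p xs) (n≤1+n _)))
  ... | true  | false = s≤s (count-∨ p q xs)
  ... | false | true  = ≤-trans (s≤s (count-∨ p q xs)) (≤-reflexive (≡.sym (+-suc _ _)))
  ... | false | false = count-∨ p q xs

  count-∨-disjoint : ∀ (p q : A → Bool) → (∀ x → T (p x) → ¬ T (q x)) →
                     ∀ xs → count p xs + count q xs ≤ count (λ x → p x ∨ q x) xs
  count-∨-disjoint p q disjoint [] = z≤n
  count-∨-disjoint p q disjoint (x ∷ xs) with p x | q x | disjoint x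
  ... | true  | true  | d = ⊥-elim (d _ _)
  ... | true  | false | _ = s≤s (count-∨-disjoint p q disjoint xs)
  ... | false | true  | _ =
    ≤-trans (≤-reflexive (+-suc _ _)) (s≤s (count-∨-disjoint p q disjoint xs))
  ... | false | false | _ = count-∨-disjoint p q disjoint xs

  count-unique-≤1 : {p : A → Bool} → (∀ x y → T (p x) → T (p y) → x ≡ y) →
                    ∀ {xs} → Unique xs → count p xs ≤ 1
  count-unique-≤1 p-unique {[]} _ = z≤n
  count-unique-≤1 {p} p-unique {x ∷ xs} (x≢xs ∷ xs-unique) with p x in px
  ... | true  = s≤s (≤-reflexive (count-none (All.map (λ x≢y py → x≢y (p-unique _ _ px′ py)) x≢xs)))
    where px′ = from T-≡ px
  ... | false = count-unique-≤1 p-unique xs-unique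

  count-any-≤ : {B : Set} (D : B → Bool) (N : B → A → Bool) (m : ℕ) (xs : List A) →
                (∀ w → T (D w) → count (N w) xs ≤ m) →
                ∀ ws → count (λ x → any (λ w → D w ∧ N w x) ws) xs ≤ count D ws * m
  count-any-≤ D N m xs bound [] = ≤-reflexive (count-none (All.universal (λ _ ()) xs))
  count-any-≤ D N m xs bound (w ∷ ws) =
    ≤-trans (count-∨ (λ x → D w ∧ N w x) _ xs) (add-w (count-any-≤ D N m xs bound ws))
    where
      add-w : ∀ {r} → r ≤ count D ws * m → count (λ x → D w ∧ N w x) xs + r ≤ count D (w ∷ ws) * m
      add-w r≤ with D w | bound w
      ... | true  | b = +-mono-≤ (b _) r≤
      ... | false | _ =
        ≤-trans (+-monoˡ-≤ _ (≤-reflexive (count-none (All.universal (λ _ ()) xs)))) r≤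

module _ {n : ℕ} where

  length-verts : length (verts {n}) ≡ n
  length-verts = length-tabulate (λ v → v)

  card-≡-≤1 : (w : Fin n) → card (λ v → eqᵇ v w) ≤ 1
  card-≡-≤1 w = count-unique-≤1 (λ u v u≡w v≡w → ≡.trans (toWitness u≡w) (≡.sym (toWitness v≡w)))
                                (allFin⁺ n)

  card-closedNbhd : (G : Graph n) (w : Fin n) → card (inN[ G ] w) ≤ suc (deg G w)
  card-closedNbhd G w =
    ≤-trans (count-∨ (λ v → eqᵇ v w) (adj G w) verts) (+-monoˡ-≤ (deg G w) (card-≡-≤1 w))

  dominating-card : {Δ : ℕ} (G : Graph n) → (∀ v → deg G v ≤ Δ) →
                    {D : Fin n → Bool} → Dominating G D → n ≤ card D * (Δ + 1)
  dominating-card {Δ} G deg≤Δ {D} D-dominating = begin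
    n                    ≡⟨ ≡.sym length-verts ⟩
    length (verts {n})   ≡⟨ ≡.sym (count-universal D-dominating verts) ⟩
    card (dom G D)       ≤⟨ count-any-≤ D (inN[ G ]) (Δ + 1) verts closedNbhd≤ verts ⟩
    card D * (Δ + 1)     ∎
    where
      open ≤-Reasoning
      closedNbhd≤ : ∀ w → T (D w) → card (inN[ G ] w) ≤ Δ + 1
      closedNbhd≤ w _ =
        ≤-trans (card-closedNbhd G w) (≤-trans (s≤s (deg≤Δ w)) (≤-reflexive (+-comm 1 Δ)))

  dom-mono : (G : Graph n) {A B : Fin n → Bool} → (∀ v → T (A v) → T (B v)) →
             ∀ u → T (dom G A u) → T (dom G B u)
  dom-mono G {A} {B} A⊆B u u∈N[A] =
    any⁺ (λ w → B w ∧ inN[ G ] w u)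
         (Any.map dominated-by-B (any⁻ (λ w → A w ∧ inN[ G ] w u) verts u∈N[A]))
    where
      dominated-by-B : ∀ {w} → T (A w ∧ inN[ G ] w u) → T (B w ∧ inN[ G ] w u)
      dominated-by-B t with to T-∧ t
      ... | w∈A , w~u = from T-∧ (A⊆B _ w∈A , w~u)

  dom-adj : (G : Graph n) {A : Fin n → Bool} {w u : Fin n} →
            T (A w) → T (adj G w u) → T (dom G A u)
  dom-adj G {A} {w} {u} w∈A w~u =
    any⁺ (λ v → A v ∧ inN[ G ] v u)
         (Any.map (λ { refl → from T-∧ (w∈A , from T-∨ (inj₂ w~u)) }) (∈-allFin w))

module Dominate {n : ℕ} (k t : ℕ) (G : Graph n) where

  private
    vs : List (Fin n)
    vs = verts

  S : ℕ → Fin n → Bool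
  S i = selected k G i

  dominated : ℕ → Fin n → Bool
  dominated i = dom G (S i)

  heavyRevealed : ℕ → Fin n → Bool
  heavyRevealed i v = heavy k t G v ∧ prefix i v

  selected-unrevealed : ∀ i v → i ≤ toℕ v → S i v ≡ false
  selected-unrevealed zero    v _ = refl
  selected-unrevealed (suc i) v i<v with toℕ v ≡ᵇ i | ≡ᵇ⇒≡ (toℕ v) i
  ... | true  | v≡i = ⊥-elim (<-irrefl (≡.sym (v≡i _)) i<v)
  ... | false | _   = selected-unrevealed i v (<⇒≤ i<v)

  selected-mono : ∀ i v → T (S i v) → T (S (suc i) v)
  selected-mono i v v∈S with toℕ v ≡ᵇ i | ≡ᵇ⇒≡ (toℕ v) i
  ... | true  | v≡i = ⊥-elim (subst T (selected-unrevealed i v (≤-reflexive (≡.sym (v≡i _)))) v∈S)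
  ... | false | _   = v∈S

  selected-at-reveal : ∀ v → S (suc (toℕ v)) v ≡ decide k G (S (toℕ v)) v
  selected-at-reveal v with toℕ v ≡ᵇ toℕ v | ≡⇒≡ᵇ (toℕ v) (toℕ v) refl
  ... | true  | _  = refl
  ... | false | ()

  card-dominated-mono : ∀ i → card (dominated i) ≤ card (dominated (suc i))
  card-dominated-mono i = count-mono (dom-mono G (selected-mono i)) vs

  heavy-dominates-new : ∀ w → T (heavy k t G w) →
                        t + card (dominated (toℕ w)) ≤ card (dominated (suc (toℕ w)))
  heavy-dominates-new w w-heavy = begin
    t + card (dominated i)                 ≤⟨ +-monoˡ-≤ _ (≤ᵇ⇒≤ t _ (proj₂ (to T-∧ w-heavy))) ⟩
    card new + card (dominated i)          ≤⟨ count-∨-disjoint new (dominated i) new∩old=∅ vs ⟩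
    card (λ u → new u ∨ dominated i u)     ≤⟨ count-mono new∪old⊆dominated vs ⟩
    card (dominated (suc i))               ∎
    where
      open ≤-Reasoning
      i = toℕ w
      new : Fin n → Bool
      new u = adj G w u ∧ not (dominated i u)
      new∩old=∅ : ∀ u → T (new u) → ¬ T (dominated i u)
      new∩old=∅ u u∈new = subst T (to T-not-≡ (proj₂ (to T-∧ u∈new)))
      w∈S : T (S (suc i) w)
      w∈S = subst T (≡.sym (selected-at-reveal w)) (proj₁ (to T-∧ w-heavy))
      new∪old⊆dominated : ∀ u → T (new u ∨ dominated i u) → T (dominated (suc i) u)
      new∪old⊆dominated u u∈new∪old with to T-∨ u∈new∪old
      ... | inj₁ u∈new = dom-adj G w∈S (proj₁ (to T-∧ u∈new))
      ... | inj₂ u∈old = dom-mono G (selected-mono i) u u∈old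

  prefix-suc : (w v : Fin n) → T (prefix (suc (toℕ w)) v) → T (prefix (toℕ w) v) ⊎ v ≡ w
  prefix-suc w v v<i+1 with m≤n⇒m<n∨m≡n (s≤s⁻¹ (≤ᵇ⇒≤ _ _ v<i+1))
  ... | inj₁ v<i = inj₁ (≤⇒≤ᵇ v<i)
  ... | inj₂ v≡i = inj₂ (toℕ-injective v≡i)

  heavyRevealed-suc : (w v : Fin n) → T (heavyRevealed (suc (toℕ w)) v) →
                      T (heavyRevealed (toℕ w) v) ⊎ v ≡ w
  heavyRevealed-suc w v v∈H with to T-∧ v∈H
  ... | v-heavy , v-revealed = map₁ (λ v-revealed′ → from T-∧ (v-heavy , v-revealed′))
                                    (prefix-suc w v v-revealed)

  heavyRevealed-step : ∀ w → card (heavyRevealed (toℕ w)) * t ≤ card (dominated (toℕ w)) →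
                       card (heavyRevealed (suc (toℕ w))) * t ≤ card (dominated (suc (toℕ w)))
  heavyRevealed-step w ih with T? (heavy k t G w)
  ... | yes w-heavy = begin
    card (heavyRevealed (suc i)) * t       ≤⟨ *-monoˡ-≤ t card-suc≤ ⟩
    t + card (heavyRevealed i) * t         ≤⟨ +-monoʳ-≤ t ih ⟩
    t + card (dominated i)                 ≤⟨ heavy-dominates-new w w-heavy ⟩
    card (dominated (suc i))               ∎
    where
      open ≤-Reasoning
      i = toℕ w
      old∪w : ∀ v → T (heavyRevealed (suc i) v) → T (heavyRevealed i v ∨ eqᵇ v w)
      old∪w v v∈H = from T-∨ (map₂ fromWitness (heavyRevealed-suc w v v∈H))
      card-suc≤ : card (heavyRevealed (suc i)) ≤ suc (card (heavyRevealed i))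
      card-suc≤ = begin
        card (heavyRevealed (suc i))                     ≤⟨ count-mono old∪w vs ⟩
        card (λ v → heavyRevealed i v ∨ eqᵇ v w)         ≤⟨ count-∨ (heavyRevealed i) (λ v → eqᵇ v w) vs ⟩
        card (heavyRevealed i) + card (λ v → eqᵇ v w)   ≤⟨ +-monoʳ-≤ _ (card-≡-≤1 w) ⟩
        card (heavyRevealed i) + 1                       ≡⟨ +-comm _ 1 ⟩
        suc (card (heavyRevealed i))                     ∎
  ... | no w-light = begin
    card (heavyRevealed (suc i)) * t       ≤⟨ *-monoˡ-≤ t (count-mono only-old vs) ⟩
    card (heavyRevealed i) * t             ≤⟨ ih ⟩
    card (dominated i)                     ≤⟨ card-dominated-mono i ⟩
    card (dominated (suc i))               ∎
    where
      open ≤-Reasoning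
      i = toℕ w
      only-old : ∀ v → T (heavyRevealed (suc i) v) → T (heavyRevealed i v)
      only-old v v∈H with heavyRevealed-suc w v v∈H
      ... | inj₁ v∈H′ = v∈H′
      ... | inj₂ refl = ⊥-elim (w-light (proj₁ (to T-∧ v∈H)))

  heavyRevealed-invariant : ∀ i → i ≤ n → card (heavyRevealed i) * t ≤ card (dominated i)
  heavyRevealed-invariant zero _ = ≤-trans (≤-reflexive (cong (_* t) none-revealed)) z≤n
    where
      none-revealed : card (heavyRevealed 0) ≡ 0
      none-revealed = count-none (All.universal (λ v v∈H → proj₂ (to T-∧ v∈H)) vs)
  heavyRevealed-invariant (suc i) i<n
    with fromℕ< i<n | toℕ-fromℕ< i<n | heavyRevealed-invariant i (<⇒≤ i<n)
  ... | w | refl | ih = heavyRevealed-step w ih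

  card-heavy : card (heavy k t G) * t ≤ n
  card-heavy = begin
    card (heavy k t G) * t           ≤⟨ *-monoˡ-≤ t (count-mono all-revealed vs) ⟩
    card (heavyRevealed n) * t       ≤⟨ heavyRevealed-invariant n ≤-refl ⟩
    card (dominated n)               ≤⟨ length-filter (T? ∘ dominated n) vs ⟩
    length vs                        ≡⟨ length-verts ⟩
    n                                ∎
    where
      open ≤-Reasoning
      all-revealed : ∀ v → T (heavy k t G v) → T (heavyRevealed n v)
      all-revealed v v-heavy = from T-∧ (v-heavy , ≤⇒≤ᵇ (toℕ<n v))

lemma7 : (Δ k n : ℕ) → 2 ≤ Δ → IsCeilSqrt Δ k →
    (G : Graph n) → (∀ v → deg G v ≤ Δ) → Admissible G → 1 ≤ n →
    (OPT : Fin n → Bool) → MinimumDominating G OPT →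
    card (heavy k k G) * card (heavy k k G) * Δ
      ≤ card OPT * card OPT * ((Δ + 1) * (Δ + 1))
lemma7 Δ k n _ (_ , Δ≤k²) G deg≤Δ _ _ OPT (OPT-dominating , _) = begin
  h * h * Δ                       ≤⟨ *-monoʳ-≤ (h * h) Δ≤k² ⟩
  h * h * (k * k)                 ≡⟨ [m*n]*[o*p]≡[m*o]*[n*p] h h k k ⟩
  (h * k) * (h * k)               ≤⟨ *-mono-≤ hk≤ hk≤ ⟩
  (o * (Δ + 1)) * (o * (Δ + 1))   ≡⟨ [m*n]*[o*p]≡[m*o]*[n*p] o (Δ + 1) o (Δ + 1) ⟩
  o * o * ((Δ + 1) * (Δ + 1))     ∎
  where
    open ≤-Reasoning
    h = card (heavy k k G)
    o = card OPT
    hk≤ : h * k ≤ o * (Δ + 1)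
    hk≤ = ≤-trans (Dominate.card-heavy k k G) (dominating-card G deg≤Δ OPT-dominating)
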